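{- Let $H$ be a closed subgroup scheme of $\mathrm{SL}_2$ over $\mathbb{Z}$ (viewed as a representable subgroup functor of $\mathrm{SL}_2$). Then for every integer $N\ge1$, the subgroup $P(H(\mathbb{Z}/N\mathbb{Z}))\subset\mathrm{PSL}_2(\mathbb{Z}/N\mathbb{Z})$ is decomposable with respect to every prime divisor $p$ of $N$.
   Context: $P\colon\mathrm{SL}_2(R)\to\mathrm{PSL}_2(R)=\mathrm{SL}_2(R)/\{\pm1\}$. Write $N=p^nM$ with $(M,p)=1$, $n\ge1$, and identify $\mathrm{SL}_2(\mathbb{Z}/N\mathbb{Z})\cong\mathrm{SL}_2(\mathbb{Z}/p^n\mathbb{Z})\times\mathrm{SL}_2(\mathbb{Z}/M\mathbb{Z})$ via the Chinese remainder theorem. A subgroup $H'\subset\mathrm{PSL}_2(\mathbb{Z}/N\mathbb{Z})$ is decomposable with respect to $p$ if there are subgroups $H_p\subset\mathrm{SL}_2(\mathbb{Z}/p^n\mathbb{Z})$ and $H_M\subset\mathrm{SL}_2(\mathbb{Z}/M\mathbb{Z})$ with $P(H_p\times H_M)=H'$. -}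

module Defs where

open import Level using (0ℓ)
open import Data.Nat using (ℕ)
open import Data.Integer as Z using (ℤ; +_)
import Data.Integer.Properties as ℤP
open import Data.Integer.Tactic.RingSolver using (solve-∀)
open import Data.Product using (Σ; ∃; _×_; _,_; proj₁; proj₂)
open import Data.Sum using (_⊎_)
open import Data.Fin using (Fin; zero; suc)
open import Function.Bundles using (_⇔_)
open import Algebra.Bundles using (CommutativeRing)
open import Algebra.Structures using (IsCommutativeRing)
open import Relation.Binary.PropositionalEquality
  using (_≡_; refl; sym; trans; cong; cong₂)

-- Z/NZ as a commutative ring: carrier ℤ, equality = congruence mod N.

module _ where
  open Z using (_*_; _-_)
  _≈[_]_ : ℤ → ℕ → ℤ → Set
  x ≈[ N ] y = ∃ λ (k : ℤ) → x - y ≡ k * + N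

module ZModProofs (N : ℕ) where
  open Z using (_+_; _*_; -_; _-_)
  private
    n = + N

  ≡⇒≈ : ∀ {x y} → x ≡ y → x ≈[ N ] y
  ≡⇒≈ {x} refl = Z.0ℤ , trans (ℤP.+-inverseʳ x) (sym (ℤP.*-zeroˡ n))

  ≈sym : ∀ {x y} → x ≈[ N ] y → y ≈[ N ] x
  ≈sym {x} {y} (k , e) = - k , (begin
      y - x     ≡⟨ l x y ⟩
      - (x - y) ≡⟨ cong -_ e ⟩
      - (k * n) ≡⟨ ℤP.neg-distribˡ-* k n ⟩
      - k * n   ∎)
    where
      open Relation.Binary.PropositionalEquality.≡-Reasoning
      l : ∀ x y → y - x ≡ - (x - y)
      l = solve-∀

  ≈trans : ∀ {x y z} → x ≈[ N ] y → y ≈[ N ] z → x ≈[ N ] z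
  ≈trans {x} {y} {z} (k , e) (l , f) = k + l , (begin
      x - z             ≡⟨ h x y z ⟩
      (x - y) + (y - z) ≡⟨ cong₂ _+_ e f ⟩
      k * n + l * n     ≡⟨ sym (ℤP.*-distribʳ-+ n k l) ⟩
      (k + l) * n       ∎)
    where
      open Relation.Binary.PropositionalEquality.≡-Reasoning
      h : ∀ x y z → x - z ≡ (x - y) + (y - z)
      h = solve-∀

  +cong : ∀ {x y u v} → x ≈[ N ] y → u ≈[ N ] v → (x + u) ≈[ N ] (y + v)
  +cong {x} {y} {u} {v} (k , e) (l , f) = k + l , (begin
      (x + u) - (y + v) ≡⟨ h x y u v ⟩
      (x - y) + (u - v) ≡⟨ cong₂ _+_ e f ⟩
      k * n + l * n     ≡⟨ sym (ℤP.*-distribʳ-+ n k l) ⟩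
      (k + l) * n       ∎)
    where
      open Relation.Binary.PropositionalEquality.≡-Reasoning
      h : ∀ x y u v → (x + u) - (y + v) ≡ (x - y) + (u - v)
      h = solve-∀

  *cong : ∀ {x y u v} → x ≈[ N ] y → u ≈[ N ] v → (x * u) ≈[ N ] (y * v)
  *cong {x} {y} {u} {v} (k , e) (l , f) = x * l + k * v , (begin
      x * u - y * v             ≡⟨ h x y u v ⟩
      x * (u - v) + (x - y) * v ≡⟨ cong₂ (λ a b → x * a + b * v) f e ⟩
      x * (l * n) + (k * n) * v ≡⟨ h2 x l n k v ⟩
      (x * l + k * v) * n       ∎)
    where
      open Relation.Binary.PropositionalEquality.≡-Reasoning
      h : ∀ x y u v → x * u - y * v ≡ x * (u - v) + (x - y) * v
      h = solve-∀
      h2 : ∀ x l n k v → x * (l * n) + (k * n) * v ≡ (x * l + k * v) * n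
      h2 = solve-∀

  -cong : ∀ {x y} → x ≈[ N ] y → (- x) ≈[ N ] (- y)
  -cong {x} {y} (k , e) = - k , (begin
      - x - - y ≡⟨ h x y ⟩
      - (x - y) ≡⟨ cong -_ e ⟩
      - (k * n) ≡⟨ ℤP.neg-distribˡ-* k n ⟩
      - k * n   ∎)
    where
      open Relation.Binary.PropositionalEquality.≡-Reasoning
      h : ∀ x y → - x - - y ≡ - (x - y)
      h = solve-∀

  isCommRing : IsCommutativeRing (λ x y → x ≈[ N ] y) _+_ _*_ -_ Z.0ℤ Z.1ℤ
  isCommRing = record
    { isRing = record
      { +-isAbelianGroup = record
        { isGroup = record
          { isMonoid = record
            { isSemigroup = record
              { isMagma = record
                { isEquivalence = record
                  { refl = λ {x} → ≡⇒≈ {x} refl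
                  ; sym = λ {x} {y} → ≈sym {x} {y}
                  ; trans = λ {x} {y} {z} → ≈trans {x} {y} {z} }
                ; ∙-cong = λ {x} {y} {u} {v} → +cong {x} {y} {u} {v} }
              ; assoc = λ x y z → ≡⇒≈ (ℤP.+-assoc x y z) }
            ; identity = (λ x → ≡⇒≈ (ℤP.+-identityˡ x))
                       , (λ x → ≡⇒≈ (ℤP.+-identityʳ x)) }
          ; inverse = (λ x → ≡⇒≈ (ℤP.+-inverseˡ x))
                    , (λ x → ≡⇒≈ (ℤP.+-inverseʳ x))
          ; ⁻¹-cong = λ {x} {y} → -cong {x} {y} }
        ; comm = λ x y → ≡⇒≈ (ℤP.+-comm x y) }
      ; *-cong = λ {x} {y} {u} {v} → *cong {x} {y} {u} {v}
      ; *-assoc = λ x y z → ≡⇒≈ (ℤP.*-assoc x y z)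
      ; *-identity = (λ x → ≡⇒≈ (ℤP.*-identityˡ x))
                   , (λ x → ≡⇒≈ (ℤP.*-identityʳ x))
      ; distrib = (λ x y z → ≡⇒≈ (ℤP.*-distribˡ-+ x y z))
                , (λ x y z → ≡⇒≈ (ℤP.*-distribʳ-+ x y z)) }
    ; *-comm = λ x y → ≡⇒≈ (ℤP.*-comm x y) }

ZMod : ℕ → CommutativeRing 0ℓ 0ℓ
ZMod N = record { isCommutativeRing = ZModProofs.isCommRing N }

-- Polynomials in Z[a,b,c,d] (syntax; the variables are the matrix
-- entries a = var 0, b = var 1, c = var 2, d = var 3 of g = (a b ; c d)).

data Poly : Set where
  var        : Fin 4 → Poly
  pzero pone : Poly
  padd pmul  : Poly → Poly → Poly
  pneg       : Poly → Poly

module Matrices (R : CommutativeRing 0ℓ 0ℓ) where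
  open CommutativeRing R

  -- a 2x2 matrix (a b ; c d) stored as (a , b , c , d)
  Mat : Set
  Mat = Carrier × Carrier × Carrier × Carrier

  entry : Mat → Fin 4 → Carrier
  entry (a , b , c , d) zero = a
  entry (a , b , c , d) (suc zero) = b
  entry (a , b , c , d) (suc (suc zero)) = c
  entry (a , b , c , d) (suc (suc (suc zero))) = d

  eval : Poly → Mat → Carrier
  eval (var i)    g = entry g i
  eval pzero      g = 0#
  eval pone       g = 1#
  eval (padd f h) g = eval f g + eval h g
  eval (pmul f h) g = eval f g * eval h g
  eval (pneg f)   g = - eval f g

  det : Mat → Carrier
  det (a , b , c , d) = a * d - b * c

  _≈M_ : Mat → Mat → Set
  (a , b , c , d) ≈M (a' , b' , c' , d') = a ≈ a' × b ≈ b' × c ≈ c' × d ≈ d'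

  idM : Mat
  idM = 1# , 0# , 0# , 1#

  _·_ : Mat → Mat → Mat
  (a , b , c , d) · (a' , b' , c' , d') =
    (a * a' + b * c') , (a * b' + b * d') , (c * a' + d * c') , (c * b' + d * d')

  -- inverse of a matrix of determinant 1
  invM : Mat → Mat
  invM (a , b , c , d) = d , - b , - c , a

  negM : Mat → Mat
  negM (a , b , c , d) = - a , - b , - c , - d

  InSL2 : Mat → Set
  InSL2 g = det g ≈ 1#

  record IsSubgroupSL2 (S : Mat → Set) : Set where
    field
      inSL2    : ∀ {g} → S g → InSL2 g
      respects : ∀ {g h} → g ≈M h → S g → S h
      hasId    : S idM
      mulClosed : ∀ {g h} → S g → S h → S (g · h)
      invClosed : ∀ {g} → S g → S (invM g)

  -- preimage in SL_2(R) of the image P(S) ⊂ PSL_2(R) = SL_2(R)/{±1}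
  PImage : (Mat → Set) → Mat → Set
  PImage S g = S g ⊎ S (negM g)

-- Closed subscheme of SL_2 over Z: the zero locus of a set I of
-- polynomials in Z[a,b,c,d] inside SL_2.  H(R) is its set of R-points.

Points : (I : Poly → Set) (R : CommutativeRing 0ℓ 0ℓ) → Matrices.Mat R → Set
Points I R g = InSL2 g × (∀ f → I f → eval f g ≈ 0#)
  where
    open CommutativeRing R
    open Matrices R

IsSubgroupScheme : (Poly → Set) → Set₁
IsSubgroupScheme I = ∀ (R : CommutativeRing 0ℓ 0ℓ) →
  Matrices.IsSubgroupSL2 R (Points I R)

-- Elements of SL_2(Z/NZ), SL_2(Z/p^nZ), SL_2(Z/MZ) are
-- all represented by integer matrices; the CRT isomorphism
-- SL_2(Z/N) ≅ SL_2(Z/p^n) × SL_2(Z/M) sends g to (g mod p^n , g mod M),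
-- i.e. the same integer matrix read in the two rings.
-- A subgroup H' = P(S) ⊂ PSL_2(Z/N) (S ⊂ SL_2(Z/N)) is decomposable with
-- respect to the factorisation N = q * M (q = p^n) iff there are subgroups
-- Hq ⊂ SL_2(Z/q), HM ⊂ SL_2(Z/M) with P(Hq × HM) = P(S).

IntMat : Set
IntMat = ℤ × ℤ × ℤ × ℤ

DecomposableWrt : (N q M : ℕ) → (IntMat → Set) → Set₁
DecomposableWrt N q M S =
  Σ (IntMat → Set) λ Hq → Σ (IntMat → Set) λ HM →
    Matrices.IsSubgroupSL2 (ZMod q) Hq ×
    Matrices.IsSubgroupSL2 (ZMod M) HM ×
    (∀ (g : IntMat) → Matrices.InSL2 (ZMod N) g →
       (Matrices.PImage (ZMod N) S g ⇔
        Matrices.PImage (ZMod N) (λ h → Hq h × HM h) g))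

-- The equations cutting out H (det = 1 and the polynomials of I) have
-- integer coefficients, so by the Chinese remainder theorem an integer
-- matrix is a Z/NZ-point of H iff it is both a Z/p^nZ-point and a
-- Z/MZ-point.  Thus H(Z/NZ) = H(Z/p^nZ) × H(Z/MZ) under the CRT
-- isomorphism, and P(H(Z/NZ)) decomposes with H_p = H(Z/p^nZ) and
-- H_M = H(Z/MZ).
module Submission where

open import Defs
open import Data.Nat using (ℕ; _≤_; _*_; _^_)
open import Data.Nat.Divisibility using (_∣_)
open import Data.Nat.Primality using (Prime)
open import Data.Nat.Coprimality using (Coprime)
open import Relation.Binary.PropositionalEquality using (_≡_)

import Data.Nat as ℕ
import Data.Nat.Properties as ℕP
import Data.Nat.Divisibility as ℕD
import Data.Nat.Coprimality as ℕC
open import Data.Integer as Z using (+_)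
import Data.Integer.Divisibility.Signed as ℤD
open import Data.Product using (_×_; _,_)
open import Data.Sum using () renaming (map to ⊎-map)
open import Data.Fin using (zero; suc)
open import Function.Bundles using (_⇔_; mk⇔; Equivalence)
open import Relation.Binary.PropositionalEquality using (refl; cong; cong₂; subst)

coprime-^ʳ : ∀ {m n} → Coprime m n → ∀ k → Coprime m (n ^ k)
coprime-^ʳ m⊥n ℕ.zero        (_   , i∣1)     = ℕD.∣1⇒≡1 i∣1
coprime-^ʳ {m} {n} m⊥n (ℕ.suc k) {i} (i∣m , i∣n*nᵏ) =
  coprime-^ʳ m⊥n k (i∣m , ℕC.coprime-divisor i⊥n i∣n*nᵏ)
  where
  i⊥n : Coprime i n
  i⊥n (j∣i , j∣n) = m⊥n (ℕD.∣-trans j∣i i∣m , j∣n)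

coprime-∣∧∣⇒*∣ : ∀ {m n o} → Coprime m n → m ∣ o → n ∣ o → m * n ∣ o
coprime-∣∧∣⇒*∣ {m} {n} m⊥n (ℕD.divides k refl) n∣k*m =
  subst (m * n ∣_) (ℕP.*-comm m k)
    (ℕD.*-monoʳ-∣ m (ℕC.coprime-divisor (ℕC.sym m⊥n)
      (subst (n ∣_) (ℕP.*-comm k m) n∣k*m)))

≈⇒∣ : ∀ {N} x y → x ≈[ N ] y → + N ℤD.∣ x Z.- y
≈⇒∣ x y (k , eq) = ℤD.divides k eq

∣⇒≈ : ∀ {N} x y → + N ℤD.∣ x Z.- y → x ≈[ N ] y
∣⇒≈ x y (ℤD.divides k eq) = k , eq

≈-reduce : ∀ {d N} → d ∣ N → ∀ x y → x ≈[ N ] y → x ≈[ d ] y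
≈-reduce d∣N x y x≈y = ∣⇒≈ x y (ℤD.∣-trans (ℤD.∣ᵤ⇒∣ d∣N) (≈⇒∣ x y x≈y))

≈-crt : ∀ {m n} → Coprime m n →
  ∀ x y → x ≈[ m ] y → x ≈[ n ] y → x ≈[ m * n ] y
≈-crt m⊥n x y x≈y x≈′y = ∣⇒≈ x y (ℤD.∣ᵤ⇒∣
  (coprime-∣∧∣⇒*∣ m⊥n (ℤD.∣⇒∣ᵤ (≈⇒∣ x y x≈y)) (ℤD.∣⇒∣ᵤ (≈⇒∣ x y x≈′y))))

eval-ZMod-irrelevant : ∀ A B f g →
  Matrices.eval (ZMod A) f g ≡ Matrices.eval (ZMod B) f g
eval-ZMod-irrelevant A B (var zero)                   g = refl
eval-ZMod-irrelevant A B (var (suc zero))             g = refl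
eval-ZMod-irrelevant A B (var (suc (suc zero)))       g = refl
eval-ZMod-irrelevant A B (var (suc (suc (suc zero)))) g = refl
eval-ZMod-irrelevant A B pzero      g = refl
eval-ZMod-irrelevant A B pone       g = refl
eval-ZMod-irrelevant A B (padd f h) g =
  cong₂ Z._+_ (eval-ZMod-irrelevant A B f g) (eval-ZMod-irrelevant A B h g)
eval-ZMod-irrelevant A B (pmul f h) g =
  cong₂ Z._*_ (eval-ZMod-irrelevant A B f g) (eval-ZMod-irrelevant A B h g)
eval-ZMod-irrelevant A B (pneg f)   g = cong Z.-_ (eval-ZMod-irrelevant A B f g)

module _ (I : Poly → Set) where

  Points-ZMod-mono : ∀ {A B g} → (∀ x y → x ≈[ A ] y → x ≈[ B ] y) →
    Points I (ZMod A) g → Points I (ZMod B) g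
  Points-ZMod-mono {A} {B} {g} A⇒B (det≈1 , zeros) =
    A⇒B (Matrices.det (ZMod A) g) Z.1ℤ det≈1 ,
    λ f f∈I → subst (_≈[ B ] Z.0ℤ) (eval-ZMod-irrelevant A B f g)
                (A⇒B (Matrices.eval (ZMod A) f g) Z.0ℤ (zeros f f∈I))

  Points-ZMod-glue : ∀ {A B C g} →
    (∀ x y → x ≈[ A ] y → x ≈[ B ] y → x ≈[ C ] y) →
    Points I (ZMod A) g → Points I (ZMod B) g → Points I (ZMod C) g
  Points-ZMod-glue {A} {B} {C} {g} glue (det≈1 , zeros) (det≈′1 , zeros′) =
    glue (Matrices.det (ZMod A) g) Z.1ℤ det≈1 det≈′1 ,
    λ f f∈I → subst (_≈[ C ] Z.0ℤ) (eval-ZMod-irrelevant A C f g)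
                (glue (Matrices.eval (ZMod A) f g) Z.0ℤ (zeros f f∈I)
                      (subst (_≈[ B ] Z.0ℤ) (eval-ZMod-irrelevant B A f g)
                        (zeros′ f f∈I)))

  Points-ZMod-crt : ∀ {m n g} → Coprime m n →
    Points I (ZMod (m * n)) g ⇔ (Points I (ZMod m) g × Points I (ZMod n) g)
  Points-ZMod-crt {m} {n} m⊥n = mk⇔
    (λ g∈H → Points-ZMod-mono (≈-reduce (ℕD.m∣m*n n)) g∈H ,
             Points-ZMod-mono (≈-reduce (ℕD.n∣m*n m)) g∈H)
    (λ (g∈Hₘ , g∈Hₙ) → Points-ZMod-glue (≈-crt m⊥n) g∈Hₘ g∈Hₙ)

lemma3p7 : (I : Poly → Set) → IsSubgroupScheme I →
    (N : ℕ) → 1 ≤ N →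
    (p : ℕ) → Prime p → p ∣ N →
    (n M : ℕ) → N ≡ p ^ n * M → Coprime M p → 1 ≤ n →
    DecomposableWrt N (p ^ n) M (Points I (ZMod N))
lemma3p7 I isSubgroupScheme _ _ p _ _ n M refl M⊥p _ =
  Points I (ZMod (p ^ n)) , Points I (ZMod M) ,
  isSubgroupScheme (ZMod (p ^ n)) , isSubgroupScheme (ZMod M) ,
  λ g _ → mk⇔ (⊎-map (to crt) (to crt)) (⊎-map (from crt) (from crt))
  where
  open Equivalence using (to; from)
  crt : ∀ {g} → Points I (ZMod (p ^ n * M)) g ⇔
                (Points I (ZMod (p ^ n)) g × Points I (ZMod M) g)
  crt = Points-ZMod-crt I (ℕC.sym (coprime-^ʳ M⊥p n))
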